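{- Let $(X,\mathcal S)$ be a core space and $R$ its interior relation. For a subset $B\subseteq X$ the following are equivalent: (1) $B$ is $R$-dense in $X$; (2) $B$ is $R$-cofinal in $X$; (3) $B$ is a core basis for $(X,\mathcal S)$; (4) $B$ is dense in $(X,\mathcal S^\alpha)$ (and hence dense in every patch space of $(X,\mathcal S)$); (5) $\{\downarrow b: b\in B\}$ is join-dense in the lattice $\mathcal S^c$ of closed sets of $(X,\mathcal S)$.
   Context: Specialization quasi-order: $x\le y\iff x\in\mathrm{cl}\{y\}$; $\uparrow x,\downarrow x$ taken w.r.t. it ($\downarrow x$ is the closure of $\{x\}$; $\uparrow x$ is the core of $x$). A core space is a space where every point has a neighborhood base of cores. Interior relation: $x\,R\,y\iff y\in\mathrm{int}_{\mathcal S}(\uparrow x)$; for a relation $R$, $x\le_R y\iff \{z:z\,R\,x\}\subseteq\{z:z\,R\,y\}$. $B$ is $R$-dense if $x\,R\,y$ implies $x\,R\,b$ and $b\,R\,y$ for some $b\in B$; $R$-cofinal if $x\,R\,y$ implies $x\le_R b$ and $b\,R\,y$ for some $b\in B$. A core basis is a $B$ such that for all $U\in\mathcal S$, $y\in U$ there is $x\in B$ with $y\in\mathrm{int}_{\mathcal S}(\uparrow x)\subseteq\uparrow x\subseteq U$. $\mathcal S^\alpha$ is the topology generated by $\mathcal S$ and all lower sets (equivalently by $\mathcal S\cup\mathcal S^c$). A patch space of $(X,\mathcal S)$ is $(X,\le,\mathcal S\vee\mathcal S')$ where $\mathcal S'$ is a topology whose specialization quasi-order is $\ge$. A subset $D$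 of a complete lattice $L$ is join-dense if every element of $L$ is a join of elements of $D$. -}

module Defs where

open import Level using (Level; 0ℓ) renaming (suc to lsuc)
open import Data.Product using (Σ; _×_; _,_)
open import Data.Unit using (⊤)
open import Relation.Nullary using (¬_)
open import Relation.Unary using (Pred; _⊆_; _∩_)

Subset : Set → Set₁
Subset X = Pred X 0ℓ

_≐_ : {X : Set} {a b : Level} → Pred X a → Pred X b → Set _
A ≐ B = (A ⊆ B) × (B ⊆ A)

⋃ : {X : Set} (I : Set) → (I → Subset X) → Subset X
⋃ I F x = Σ I λ i → F i x

record Topology (X : Set) : Set₂ where
  field
    Open     : Subset X → Set₁
    open-ext : ∀ {U V} → U ≐ V → Open U → Open V
    open-X   : Open (λ _ → ⊤)
    open-∩   : ∀ {U V} → Open U → Open V → Open (U ∩ V)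
    open-⋃   : (I : Set) (F : I → Subset X) → (∀ i → Open (F i)) → Open (⋃ I F)
open Topology public

data Gen {X : Set} (𝒢 : Subset X → Set₁) : Subset X → Set₁ where
  gen-base : ∀ {U} → 𝒢 U → Gen 𝒢 U
  gen-ext  : ∀ {U V} → U ≐ V → Gen 𝒢 U → Gen 𝒢 V
  gen-X    : Gen 𝒢 (λ _ → ⊤)
  gen-∩    : ∀ {U V} → Gen 𝒢 U → Gen 𝒢 V → Gen 𝒢 (U ∩ V)
  gen-⋃    : (I : Set) (F : I → Subset X) → (∀ i → Gen 𝒢 (F i)) → Gen 𝒢 (⋃ I F)

Generated : {X : Set} → (Subset X → Set₁) → Topology X
Generated 𝒢 = record
  { Open = Gen 𝒢 ; open-ext = gen-ext ; open-X = gen-X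
  ; open-∩ = gen-∩ ; open-⋃ = gen-⋃ }

-- Specialization quasi-order: x ≤ y iff x ∈ cl{y},
-- i.e. every open neighbourhood of x contains y.
_≤[_]_ : {X : Set} → X → Topology X → X → Set₁
x ≤[ S ] y = ∀ U → Open S U → U x → U y

module _ {X : Set} (S : Topology X) where

  -- ↑ x (the core of x) and ↓ x (the closure of {x}).
  ↑ : X → Pred X (lsuc 0ℓ)
  ↑ x y = x ≤[ S ] y

  ↓ : X → Pred X (lsuc 0ℓ)
  ↓ x y = y ≤[ S ] x

  int : {a : Level} → Pred X a → Pred X (lsuc 0ℓ Level.⊔ a)
  int A y = Σ (Subset X) λ U → Open S U × U y × (U ⊆ A)

  R : X → X → Set₁
  R x y = int (↑ x) y

  _≤R_ : X → X → Set₁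
  x ≤R y = ∀ z → R z x → R z y

  CoreSpace : Set₁
  CoreSpace = ∀ U y → Open S U → U y →
    Σ X λ x → int (↑ x) y × (↑ x ⊆ U)

  RDense : Subset X → Set₁
  RDense B = ∀ x y → R x y → Σ X λ b → B b × R x b × R b y

  RCofinal : Subset X → Set₁
  RCofinal B = ∀ x y → R x y → Σ X λ b → B b × x ≤R b × R b y

  CoreBasis : Subset X → Set₁
  CoreBasis B = ∀ U y → Open S U → U y →
    Σ X λ x → B x × int (↑ x) y × (↑ x ⊆ U)

  IsLower : Subset X → Set₁
  IsLower L = ∀ x y → x ≤[ S ] y → L y → L x

  Sα : Topology X
  Sα = Generated (λ U → Open S U ⊎' IsLower U)
    where
    open import Data.Sum using () renaming (_⊎_ to _⊎'_)

  IsClosed : Subset X → Set₁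
  IsClosed C = Σ (Subset X) λ U → Open S U × (∀ x → (C x → ¬ U x) × (¬ U x → C x))

  -- { ↓ b : b ∈ B } is join-dense in the complete lattice S^c of closed sets
  -- (ordered by inclusion): every closed set C is the join (least upper bound
  -- in S^c) of { ↓ b : b ∈ E } for some E ⊆ B.
  JoinDenseDown : Subset X → Set₁
  JoinDenseDown B = ∀ C → IsClosed C →
    Σ (Subset X) λ E → (E ⊆ B)
      × (∀ b → E b → ↓ b ⊆ C)
      × (∀ C' → IsClosed C' → (∀ b → E b → ↓ b ⊆ C') → C ⊆ C')

Dense : {X : Set} → Topology X → Subset X → Set₁
Dense {X} T B = ∀ U → Open T U → Σ X U → Σ X λ b → B b × U b

_∨T_ : {X : Set} → Topology X → Topology X → Topology X
S ∨T S' = Generated (λ U → Open S U ⊎' Open S' U)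
  where open import Data.Sum using () renaming (_⊎_ to _⊎'_)

HasReverseSpecialization : {X : Set} → Topology X → Topology X → Set₁
HasReverseSpecialization {X} S S' =
  ∀ x y → (x ≤[ S' ] y → y ≤[ S ] x) × (y ≤[ S ] x → x ≤[ S' ] y)

-- B is dense in every patch space (X, ≤, S ∨ S') of (X, S).
DenseInAllPatches : {X : Set} → Topology X → Subset X → Set₂
DenseInAllPatches S B =
  ∀ S' → HasReverseSpecialization S S' → Dense (S ∨T S') B

-- In a core space the interior relation R interpolates: x R y gives x R w R y.  The
-- basic open sets of S^α are U ∩ L with U open and L lower; a core basis meets them
-- since b R y implies b ≤ y, and conversely S^α-density applied to V ∩ {b : b R y},
-- where V witnesses x R w, yields an interpolant in B.  Closed sets are lower, so
-- S^α-density puts a point of B ∩ C into every open set meeting C, which makes C the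
-- join of the ↓ b below it; conversely ↓ y is closed, and join-density for it supplies
-- points of B in every neighbourhood of y.  Patch topologies are coarser than S^α.
module Submission where

open import Defs
open import Data.Product using (_×_; Σ; _,_; proj₁; proj₂)
open import Data.Sum using (_⊎_; inj₁; inj₂)
open import Data.Unit using (tt)
open import Function using (_∘_)
open import Function.Bundles using (_⇔_; mk⇔)
open import Relation.Nullary using (¬_)
open import Relation.Nullary.Decidable using (True; toWitness; fromWitness; decidable-stable)
open import Relation.Unary using (_⊆_; _∩_)
open import Axiom.ExcludedMiddle using (ExcludedMiddle)

Gen-least : {X : Set} {𝒢 : Subset X → Set₁} (T : Topology X) →
            (∀ {U} → 𝒢 U → Open T U) → ∀ {U} → Gen 𝒢 U → Open T U
Gen-least T base (gen-base g)    = base g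
Gen-least T base (gen-ext e g)   = open-ext T e (Gen-least T base g)
Gen-least T base gen-X           = open-X T
Gen-least T base (gen-∩ g h)     = open-∩ T (Gen-least T base g) (Gen-least T base h)
Gen-least T base (gen-⋃ I F gs)  = open-⋃ T I F (λ i → Gen-least T base (gs i))

module _ {X : Set} (S : Topology X) where

  ≤-refl : ∀ x → x ≤[ S ] x
  ≤-refl x U _ Ux = Ux

  ≤-trans : ∀ {x y z} → x ≤[ S ] y → y ≤[ S ] z → x ≤[ S ] z
  ≤-trans x≤y y≤z U U-open Ux = y≤z U U-open (x≤y U U-open Ux)

  R⇒≤ : ∀ {x y} → R S x y → x ≤[ S ] y
  R⇒≤ (V , _ , Vy , V⊆↑x) = V⊆↑x Vy

  R-≤-trans : ∀ {w x y} → w ≤[ S ] x → R S x y → R S w y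
  R-≤-trans w≤x (V , V-open , Vy , V⊆↑x) = V , V-open , Vy , ≤-trans w≤x ∘ V⊆↑x

  R-respʳ-≤ : ∀ {x y z} → R S x y → y ≤[ S ] z → R S x z
  R-respʳ-≤ (V , V-open , Vy , V⊆↑x) y≤z = V , V-open , y≤z V V-open Vy , V⊆↑x

  R-interpolate : CoreSpace S → ∀ {x y} → R S x y → Σ X λ w → R S x w × R S w y
  R-interpolate core (V , V-open , Vy , V⊆↑x) with core V _ V-open Vy
  ... | w , Rwy , ↑w⊆V = w , (V , V-open , ↑w⊆V (≤-refl w) , V⊆↑x) , Rwy

  closed⇒lower : ∀ {C} → IsClosed S C → IsLower S C
  closed⇒lower (U , U-open , C≐¬U) z b z≤b Cb =
    proj₂ (C≐¬U z) λ Uz → proj₁ (C≐¬U b) Cb (z≤b U U-open Uz)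

  record BasicNbhd (W : Subset X) (y : X) : Set₁ where
    field
      U       : Subset X
      U-open  : Open S U
      U∋y     : U y
      L       : Subset X
      L-lower : IsLower S L
      L∋y     : L y
      U∩L⊆W   : ∀ {z} → U z → L z → W z

  BasicNbhd-mono : ∀ {W V y} → (∀ {z} → W z → V z) → BasicNbhd W y → BasicNbhd V y
  BasicNbhd-mono W⊆V N = record { BasicNbhd N ; U∩L⊆W = λ Uz Lz → W⊆V (BasicNbhd.U∩L⊆W N Uz Lz) }

  Sα-basicNbhd : ∀ {W} → Open (Sα S) W → ∀ {y} → W y → BasicNbhd W y
  Sα-basicNbhd (gen-base (inj₁ W-open)) Wy =
    record { U = _ ; U-open = W-open ; U∋y = Wy ; L = _ ; L-lower = λ _ _ _ _ → tt
           ; L∋y = tt ; U∩L⊆W = λ Uz _ → Uz }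
  Sα-basicNbhd (gen-base (inj₂ W-lower)) Wy =
    record { U = _ ; U-open = open-X S ; U∋y = tt ; L = _ ; L-lower = W-lower
           ; L∋y = Wy ; U∩L⊆W = λ _ Lz → Lz }
  Sα-basicNbhd gen-X _ =
    record { U = _ ; U-open = open-X S ; U∋y = tt ; L = _ ; L-lower = λ _ _ _ _ → tt
           ; L∋y = tt ; U∩L⊆W = λ _ _ → tt }
  Sα-basicNbhd (gen-ext (W⊆V , V⊆W) g) Vy = BasicNbhd-mono W⊆V (Sα-basicNbhd g (V⊆W Vy))
  Sα-basicNbhd (gen-∩ g h) (Wy , Vy) =
    let module M = BasicNbhd (Sα-basicNbhd g Wy)
        module N = BasicNbhd (Sα-basicNbhd h Vy)
    in record { U = M.U ∩ N.U ; U-open = open-∩ S M.U-open N.U-open ; U∋y = M.U∋y , N.U∋y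
              ; L = M.L ∩ N.L
              ; L-lower = λ z b z≤b Lb → M.L-lower z b z≤b (proj₁ Lb) , N.L-lower z b z≤b (proj₂ Lb)
              ; L∋y = M.L∋y , N.L∋y
              ; U∩L⊆W = λ Uz Lz → M.U∩L⊆W (proj₁ Uz) (proj₁ Lz) , N.U∩L⊆W (proj₂ Uz) (proj₂ Lz) }
  Sα-basicNbhd (gen-⋃ I F gs) (i , Fy) = BasicNbhd-mono (i ,_) (Sα-basicNbhd (gs i) Fy)

  module _ {B : Subset X} where

    meets-basicNbhds⇒Sα-dense : (∀ {W y} → BasicNbhd W y → Σ X λ b → B b × W b) → Dense (Sα S) B
    meets-basicNbhds⇒Sα-dense meets W W-open (y , Wy) = meets (Sα-basicNbhd W-open Wy)

    RDense⇒RCofinal : RDense S B → RCofinal S B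
    RDense⇒RCofinal dense x y Rxy with dense x y Rxy
    ... | b , Bb , Rxb , Rby = b , Bb , (λ z Rzx → R-respʳ-≤ Rzx (R⇒≤ Rxb)) , Rby

    RCofinal⇒CoreBasis : CoreSpace S → RCofinal S B → CoreBasis S B
    RCofinal⇒CoreBasis core cofinal U y U-open Uy with core U y U-open Uy
    ... | x , Rxy , ↑x⊆U with R-interpolate core Rxy
    ... | w , Rxw , Rwy with cofinal w y Rwy
    ... | b , Bb , w≤Rb , Rby = b , Bb , Rby , ↑x⊆U ∘ ≤-trans (R⇒≤ (w≤Rb x Rxw))

    CoreBasis⇒Sα-dense : CoreBasis S B → Dense (Sα S) B
    CoreBasis⇒Sα-dense basis = meets-basicNbhds⇒Sα-dense λ N →
      let open BasicNbhd N
          b , Bb , Rby , ↑b⊆U = basis U _ U-open U∋y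
      in b , Bb , U∩L⊆W (↑b⊆U (≤-refl b)) (L-lower b _ (R⇒≤ Rby) L∋y)

    Sα-dense⇒JoinDense↓ : Dense (Sα S) B → JoinDenseDown S B
    Sα-dense⇒JoinDense↓ dense C C-closed =
      (λ b → B b × C b) , proj₁ ,
      (λ b (_ , Cb) z≤b → closed⇒lower C-closed _ b z≤b Cb) , least
      where
      least : ∀ C′ → IsClosed S C′ → (∀ b → B b × C b → ↓ S b ⊆ C′) → C ⊆ C′
      least C′ (U′ , U′-open , C′≐¬U′) ↓⊆C′ {y} Cy = proj₂ (C′≐¬U′ y) λ U′y →
        let b , Bb , U′b , Cb = dense (U′ ∩ C)
              (gen-∩ (gen-base (inj₁ U′-open)) (gen-base (inj₂ (closed⇒lower C-closed))))
              (y , U′y , Cy)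
        in proj₁ (C′≐¬U′ b) (↓⊆C′ b (Bb , Cb) (≤-refl b)) U′b

    Sα-dense⇒patch-dense : Dense (Sα S) B → DenseInAllPatches S B
    Sα-dense⇒patch-dense dense S′ reverse W W-open =
      dense W (Gen-least (Sα S) patch-generator⇒Sα-open W-open)
      where
      patch-generator⇒Sα-open : ∀ {U} → Open S U ⊎ Open S′ U → Open (Sα S) U
      patch-generator⇒Sα-open (inj₁ U-open)  = gen-base (inj₁ U-open)
      patch-generator⇒Sα-open (inj₂ U-open′) =
        gen-base (inj₂ λ x y x≤y Uy → proj₂ (reverse y x) x≤y _ U-open′ Uy)

-- Excluded middle resizes the large propositions R b y and w ≤ y to subsets of X.
module _ (em : ∀ {ℓ} → ExcludedMiddle ℓ) {X : Set} (S : Topology X) where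

  Small : ∀ {ℓ} → Set ℓ → Set
  Small P = True (em {P = P})

  small : ∀ {ℓ} {P : Set ℓ} → P → Small P
  small = fromWitness

  unsmall : ∀ {ℓ} {P : Set ℓ} → Small P → P
  unsmall = toWitness

  R⁻¹ : X → Subset X
  R⁻¹ y b = Small (R S b y)

  R⁻¹-lower : ∀ y → IsLower S (R⁻¹ y)
  R⁻¹-lower y a b a≤b Rby = small (R-≤-trans S a≤b (unsmall Rby))

  ↓ₛ : X → Subset X
  ↓ₛ y w = Small (w ≤[ S ] y)

  separate : ∀ {z y} → ¬ (z ≤[ S ] y) → Σ (Subset X) λ U → Open S U × U z × ¬ U y
  separate z≰y = decidable-stable em λ ¬separated →
    z≰y λ U U-open Uz → decidable-stable em λ ¬Uy → ¬separated (U , U-open , Uz , ¬Uy)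

  ↓ₛ-closed : ∀ y → IsClosed S (↓ₛ y)
  ↓ₛ-closed y = ⋃ I F , open-⋃ S I F F-open , λ w → ↓ₛ⇒¬⋃ w , ¬⋃⇒↓ₛ w
    where
    -- Indexed by points rather than open sets: unions are only over small index types.
    I : Set
    I = Σ X λ z → Small (¬ (z ≤[ S ] y))

    separation : (i : I) → Σ (Subset X) λ U → Open S U × U (proj₁ i) × ¬ U y
    separation (z , z≰y) = separate (unsmall z≰y)

    F : I → Subset X
    F = proj₁ ∘ separation

    F-open : ∀ i → Open S (F i)
    F-open = proj₁ ∘ proj₂ ∘ separation

    ↓ₛ⇒¬⋃ : ∀ w → ↓ₛ y w → ¬ ⋃ I F w
    ↓ₛ⇒¬⋃ w w≤y (i , Fw) = proj₂ (proj₂ (proj₂ (separation i))) (unsmall w≤y (F i) (F-open i) Fw)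

    ¬⋃⇒↓ₛ : ∀ w → ¬ ⋃ I F w → ↓ₛ y w
    ¬⋃⇒↓ₛ w ¬⋃w = small (decidable-stable em λ w≰y →
      ¬⋃w ((w , small w≰y) , proj₁ (proj₂ (proj₂ (separation (w , small w≰y))))))

  module _ {B : Subset X} where

    Sα-dense⇒RDense : CoreSpace S → Dense (Sα S) B → RDense S B
    Sα-dense⇒RDense core dense x y Rxy with R-interpolate S core Rxy
    ... | w , (V , V-open , Vw , V⊆↑x) , Rwy
      with dense (V ∩ R⁻¹ y) (gen-∩ (gen-base (inj₁ V-open)) (gen-base (inj₂ (R⁻¹-lower y))))
                 (w , Vw , small Rwy)
    ... | b , Bb , Vb , Rby = b , Bb , (V , V-open , Vb , V⊆↑x) , unsmall Rby

    JoinDense↓⇒Sα-dense : JoinDenseDown S B → Dense (Sα S) B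
    JoinDense↓⇒Sα-dense joinDense = meets-basicNbhds⇒Sα-dense S λ {_} {y} N →
      let open BasicNbhd N
          E , E⊆B , ↓E⊆↓y , ↓y-least = joinDense (↓ₛ y) (↓ₛ-closed y)
          b , Eb , Ub = decidable-stable em λ ¬E∩U →
            ↓y-least (λ w → ¬ U w) (U , U-open , λ _ → (λ ¬Uw → ¬Uw) , (λ ¬Uw → ¬Uw))
                     (λ b Eb w≤b Uw → ¬E∩U (b , Eb , w≤b U U-open Uw))
                     (small (≤-refl S y)) U∋y
      in b , E⊆B Eb , U∩L⊆W Ub (L-lower b y (unsmall (↓E⊆↓y b Eb (≤-refl S b))) L∋y)

proposition9p1 : (em : ∀ {ℓ} → ExcludedMiddle ℓ)
    → {X : Set} (S : Topology X) → CoreSpace S → (B : Subset X)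
    → (RDense S B ⇔ RCofinal S B)
      × (RCofinal S B ⇔ CoreBasis S B)
      × (CoreBasis S B ⇔ Dense (Sα S) B)
      × (Dense (Sα S) B ⇔ JoinDenseDown S B)
      × (Dense (Sα S) B → DenseInAllPatches S B)
proposition9p1 em S core B =
    mk⇔ (RDense⇒RCofinal S) (basis⇒dense ∘ RCofinal⇒CoreBasis S core)
  , mk⇔ (RCofinal⇒CoreBasis S core) (RDense⇒RCofinal S ∘ basis⇒dense)
  , mk⇔ (CoreBasis⇒Sα-dense S)
        (RCofinal⇒CoreBasis S core ∘ RDense⇒RCofinal S ∘ Sα-dense⇒RDense em S core)
  , mk⇔ (Sα-dense⇒JoinDense↓ S) (JoinDense↓⇒Sα-dense em S)
  , Sα-dense⇒patch-dense S
  where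
  basis⇒dense : CoreBasis S B → RDense S B
  basis⇒dense = Sα-dense⇒RDense em S core ∘ CoreBasis⇒Sα-dense S
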